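{- Let $k$ be a positive integer and let $w \in \{0,1\}^\omega$ be such that every factor of $w$ of length $k$ contains at most one occurrence of $1$. Then $\mathcal P^{(k)}_w(n) = \Theta(\mathcal P^{(1)}_w(n))$ as $n \to \infty$.
   Context: For a finite word $u$ and a nonempty word $x$, $|u|_x$ denotes the number of occurrences of $x$ as a factor of $u$. Two finite words $u, v$ are $k$-Abelian equivalent if $|u|_x = |v|_x$ for all nonempty words $x$ of length at most $k$ (for $k=1$ this is Abelian equivalence). For an infinite word $w$, $\mathcal P^{(k)}_w(n)$ is the number of $k$-Abelian equivalence classes among the factors of $w$ of length $n$. -}

module Defs where

open import Data.Bool using (Bool; true; false; _∧_; if_then_else_)
open import Data.Nat using (ℕ; zero; suc; _+_; _≤_)
open import Data.List using (List; []; _∷_; length)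
open import Data.Fin using (Fin)
open import Data.Product using (Σ; ∃; _×_)
open import Relation.Binary.PropositionalEquality using (_≡_)

-- Boolean equality on letters of the alphabet {0,1} (false = 0, true = 1)
eqb : Bool → Bool → Bool
eqb true  true  = true
eqb false false = true
eqb _     _     = false

isPrefix : List Bool → List Bool → Bool
isPrefix []      _       = true
isPrefix (_ ∷ _) []      = false
isPrefix (a ∷ x) (b ∷ u) = eqb a b ∧ isPrefix x u

-- occ x u = |u|_x, the number of occurrences of x as a factor of u
-- (number of positions of u at which x starts); only used for nonempty x.
occ : List Bool → List Bool → ℕ
occ x []      = 0
occ x (a ∷ u) = (if isPrefix x (a ∷ u) then 1 else 0) + occ x u

_≡[_]ᴬ_ : List Bool → ℕ → List Bool → Set
u ≡[ k ]ᴬ v = (x : List Bool) → 1 ≤ length x → length x ≤ k → occ x u ≡ occ x v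

InfWord : Set
InfWord = ℕ → Bool

factor : InfWord → ℕ → ℕ → List Bool
factor w i zero    = []
factor w i (suc n) = w i ∷ factor w (suc i) n

-- "P^(k)_w(n) = m": the factors of w of length n fall into exactly m
-- k-Abelian equivalence classes, i.e. there are m factors (given by starting
-- positions) that are pairwise non-equivalent and such that every factor of
-- length n is equivalent to one of them.
IsKAbComplexity : ℕ → InfWord → ℕ → ℕ → Set
IsKAbComplexity k w n m =
  Σ (Fin m → ℕ) λ pos →
    ((a b : Fin m) → factor w (pos a) n ≡[ k ]ᴬ factor w (pos b) n → a ≡ b)
    × ((i : ℕ) → ∃ λ (a : Fin m) → factor w i n ≡[ k ]ᴬ factor w (pos a) n)

-- In a word in which every window of length k = m + 1 contains at most one 1, consecutive 1s are
-- separated by at least m zeros. Deleting one zero from a run of more than m zeros removes exactly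
-- one occurrence of each 0^j with j ≤ k and changes no other count of a factor of length ≤ k, so two
-- factors of equal length whose runs of zeros, once cut down to length m, agree are k-Abelian
-- equivalent. After this reduction every interior run has length exactly m, so the reduced factor
-- is determined by its number of 1s, an Abelian invariant, and its leading and trailing runs, of
-- length at most m each. Hence every Abelian class contains at most k² k-Abelian classes, while
-- k-Abelian equivalence refines Abelian equivalence: P⁽¹⁾ ≤ P⁽ᵏ⁾ ≤ k² P⁽¹⁾.

module Submission where

open import Defs
open import Data.Bool using (Bool; true; false; _∧_; if_then_else_)
open import Data.Nat using (ℕ; zero; suc; _+_; _*_; _≤_; _<_; z≤n; s≤s; _≤?_)
open import Data.Nat.Properties
  using ( ≤-refl; ≤-trans; <⇒≤; ≤-pred; ≤-antisym; ≰⇒>; n≤0⇒n≡0; n>0⇒n≢0; m≤m+n; m+n≡0⇒n≡0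
        ; suc-injective; +-suc; +-assoc; +-identityʳ; +-cancelˡ-≡; *-zeroʳ; +-commutativeSemigroup)
open import Algebra.Properties.CommutativeSemigroup +-commutativeSemigroup using (x∙yz≈y∙xz)
open import Data.List using (List; []; _∷_; length; take; replicate)
open import Data.Product using (∃; _×_; _,_; proj₁; proj₂)
open import Data.Unit using (⊤; tt)
open import Data.Fin using (Fin; fromℕ<; combine)
open import Data.Fin.Properties using (injective⇒≤; combine-injective; fromℕ<-injective)
open import Relation.Binary.PropositionalEquality
open import Relation.Nullary using (yes; no; contradiction)
open ≡-Reasoning

zeros : ℕ → List Bool
zeros n = replicate n false

indicator : Bool → ℕ
indicator b = if b then 1 else 0

ones : List Bool → ℕ
ones = occ (true ∷ [])

leadingZeros : List Bool → ℕ
leadingZeros []          = 0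
leadingZeros (true ∷ _)  = 0
leadingZeros (false ∷ u) = suc (leadingZeros u)

sucIfZero : ℕ → ℕ → ℕ
sucIfZero zero    t = suc t
sucIfZero (suc _) t = t

sucIfZero-injective : ∀ c {s t} → sucIfZero c s ≡ sucIfZero c t → s ≡ t
sucIfZero-injective zero    = suc-injective
sucIfZero-injective (suc _) = λ s≡t → s≡t

-- A leading 0 belongs to the trailing run exactly when no 1 follows it.
trailingZeros : List Bool → ℕ
trailingZeros []          = 0
trailingZeros (true ∷ u)  = trailingZeros u
trailingZeros (false ∷ u) = sucIfZero (ones u) (trailingZeros u)

leadingZeros-zeros : ∀ n → leadingZeros (zeros n) ≡ n
leadingZeros-zeros zero    = refl
leadingZeros-zeros (suc n) = cong suc (leadingZeros-zeros n)

ones≡0⇒≡zeros : ∀ u → ones u ≡ 0 → u ≡ zeros (trailingZeros u)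
ones≡0⇒≡zeros []          _ = refl
ones≡0⇒≡zeros (false ∷ u) h rewrite h = cong (false ∷_) (ones≡0⇒≡zeros u h)

ones≡0⇒leadingZeros≡trailingZeros : ∀ u → ones u ≡ 0 → leadingZeros u ≡ trailingZeros u
ones≡0⇒leadingZeros≡trailingZeros u h =
  trans (cong leadingZeros (ones≡0⇒≡zeros u h)) (leadingZeros-zeros (trailingZeros u))

isPrefix-take : ∀ x j u → length x ≤ j → isPrefix x u ≡ isPrefix x (take j u)
isPrefix-take []      _       _       _           = refl
isPrefix-take (_ ∷ _) (suc _) []      _           = refl
isPrefix-take (a ∷ x) (suc j) (b ∷ u) (s≤s |x|≤j) = cong (eqb a b ∧_) (isPrefix-take x j u |x|≤j)

zeros-isPrefix⇒take : ∀ {k} j r → isPrefix (zeros k) r ≡ true → j ≤ k → take j r ≡ zeros j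
zeros-isPrefix⇒take {_}     zero    _           _ _         = refl
zeros-isPrefix⇒take {suc k} (suc j) (false ∷ r) h (s≤s j≤k) = cong (false ∷_) (zeros-isPrefix⇒take j r h j≤k)

zeros-isPrefix : ∀ j r → j ≤ leadingZeros r → isPrefix (zeros j) r ≡ true
zeros-isPrefix zero    _           _         = refl
zeros-isPrefix (suc j) (false ∷ r) (s≤s j≤l) = zeros-isPrefix j r j≤l

isPrefix⇒0<occ : ∀ x a u → isPrefix x (a ∷ u) ≡ true → 0 < occ x (a ∷ u)
isPrefix⇒0<occ x a u h rewrite h = s≤s z≤n

≤leadingZeros : ∀ j u → ones (take j u) ≡ 0 → 0 < ones u → j ≤ leadingZeros u
≤leadingZeros zero    _           _ _ = z≤n
≤leadingZeros (suc j) (false ∷ u) h p = s≤s (≤leadingZeros j u h p)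

length-factor : ∀ w i n → length (factor w i n) ≡ n
length-factor w i zero    = refl
length-factor w i (suc n) = cong suc (length-factor w (suc i) n)

ones-take-factor : ∀ w i j n → ones (take j (factor w i n)) ≤ ones (factor w i j)
ones-take-factor w i zero    n       = z≤n
ones-take-factor w i (suc j) zero    = z≤n
ones-take-factor w i (suc j) (suc n) with w i
... | true  = s≤s (ones-take-factor w (suc i) j n)
... | false = ones-take-factor w (suc i) j n

module ZeroRuns (m : ℕ) where

  -- Cuts every run of zeros down to length m.
  reduce : List Bool → List Bool
  reduce []          = []
  reduce (true ∷ u)  = true ∷ reduce u
  reduce (false ∷ u) = if isPrefix (zeros m) (reduce u) then reduce u else false ∷ reduce u

  removed : List Bool → ℕ
  removed []          = 0
  removed (true ∷ u)  = removed u
  removed (false ∷ u) = if isPrefix (zeros m) (reduce u) then suc (removed u) else removed u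

  take-reduce : ∀ j u → j ≤ m → take j (reduce u) ≡ take j u
  take-reduce zero    _           _   = refl
  take-reduce (suc j) []          _   = refl
  take-reduce (suc j) (true ∷ u)  j<m = cong (true ∷_) (take-reduce j u (<⇒≤ j<m))
  take-reduce (suc j) (false ∷ u) j<m with isPrefix (zeros m) (reduce u) in eq
  ... | false = cong (false ∷_) (take-reduce j u (<⇒≤ j<m))
  ... | true  = begin
    take (suc j) (reduce u)    ≡⟨ zeros-isPrefix⇒take (suc j) (reduce u) eq j<m ⟩
    zeros (suc j)              ≡⟨ cong (false ∷_) (sym (zeros-isPrefix⇒take j (reduce u) eq (<⇒≤ j<m))) ⟩
    false ∷ take j (reduce u)  ≡⟨ cong (false ∷_) (take-reduce j u (<⇒≤ j<m)) ⟩
    false ∷ take j u           ∎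

  length-reduce : ∀ u → length u ≡ length (reduce u) + removed u
  length-reduce []          = refl
  length-reduce (true ∷ u)  = cong suc (length-reduce u)
  length-reduce (false ∷ u) with isPrefix (zeros m) (reduce u)
  ... | false = cong suc (length-reduce u)
  ... | true  = trans (cong suc (length-reduce u)) (sym (+-suc _ _))

  isZeroRun : List Bool → ℕ
  isZeroRun x = indicator (isPrefix x (zeros (suc m)))

  isPrefix-∷-reduce : ∀ x a u → length x ≤ suc m → isPrefix x (a ∷ u) ≡ isPrefix x (a ∷ reduce u)
  isPrefix-∷-reduce x a u |x|≤k = begin
    isPrefix x (a ∷ u)                 ≡⟨ isPrefix-take x (suc m) (a ∷ u) |x|≤k ⟩
    isPrefix x (a ∷ take m u)          ≡⟨ cong (λ t → isPrefix x (a ∷ t)) (sym (take-reduce m u ≤-refl)) ⟩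
    isPrefix x (a ∷ take m (reduce u)) ≡⟨ sym (isPrefix-take x (suc m) (a ∷ reduce u) |x|≤k) ⟩
    isPrefix x (a ∷ reduce u)          ∎

  occ-∷-reduce : ∀ x a u → length x ≤ suc m → occ x u ≡ occ x (reduce u) + removed u * isZeroRun x
               → occ x (a ∷ u) ≡ occ x (a ∷ reduce u) + removed u * isZeroRun x
  occ-∷-reduce x a u |x|≤k ih = begin
    indicator (isPrefix x (a ∷ u)) + occ x u
      ≡⟨ cong₂ _+_ (cong indicator (isPrefix-∷-reduce x a u |x|≤k)) ih ⟩
    indicator (isPrefix x (a ∷ reduce u)) + (occ x (reduce u) + removed u * isZeroRun x)
      ≡⟨ sym (+-assoc (indicator (isPrefix x (a ∷ reduce u))) _ _) ⟩
    occ x (a ∷ reduce u) + removed u * isZeroRun x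
      ∎

  occ-reduce : ∀ x → length x ≤ suc m → ∀ u → occ x u ≡ occ x (reduce u) + removed u * isZeroRun x
  occ-reduce x |x|≤k []          = refl
  occ-reduce x |x|≤k (true ∷ u)  = occ-∷-reduce x true u |x|≤k (occ-reduce x |x|≤k u)
  occ-reduce x |x|≤k (false ∷ u) with isPrefix (zeros m) (reduce u) in eq
  ... | false = occ-∷-reduce x false u |x|≤k (occ-reduce x |x|≤k u)
  ... | true  = begin
    indicator (isPrefix x (false ∷ u)) + occ x u
      ≡⟨ cong₂ _+_ (cong indicator dropped-zero) (occ-reduce x |x|≤k u) ⟩
    isZeroRun x + (occ x (reduce u) + removed u * isZeroRun x)
      ≡⟨ x∙yz≈y∙xz (isZeroRun x) (occ x (reduce u)) _ ⟩
    occ x (reduce u) + suc (removed u) * isZeroRun x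
      ∎
    where
    dropped-zero : isPrefix x (false ∷ u) ≡ isPrefix x (zeros (suc m))
    dropped-zero = begin
      isPrefix x (false ∷ u)          ≡⟨ isPrefix-take x (suc m) (false ∷ u) |x|≤k ⟩
      isPrefix x (false ∷ take m u)   ≡⟨ cong (λ t → isPrefix x (false ∷ t)) (sym (take-reduce m u ≤-refl)) ⟩
      isPrefix x (false ∷ take m (reduce u))
        ≡⟨ cong (λ t → isPrefix x (false ∷ t)) (zeros-isPrefix⇒take m (reduce u) eq ≤-refl) ⟩
      isPrefix x (zeros (suc m))      ∎

  reduce-≡⇒≡ᴬ : ∀ u v → length u ≡ length v → reduce u ≡ reduce v → u ≡[ suc m ]ᴬ v
  reduce-≡⇒≡ᴬ u v |u|≡|v| ru≡rv x _ |x|≤k = begin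
    occ x u                                    ≡⟨ occ-reduce x |x|≤k u ⟩
    occ x (reduce u) + removed u * isZeroRun x ≡⟨ cong₂ (λ r e → occ x r + e * isZeroRun x) ru≡rv removed-≡ ⟩
    occ x (reduce v) + removed v * isZeroRun x ≡⟨ sym (occ-reduce x |x|≤k v) ⟩
    occ x v                                    ∎
    where
    removed-≡ : removed u ≡ removed v
    removed-≡ = +-cancelˡ-≡ (length (reduce u)) _ _ (begin
      length (reduce u) + removed u ≡⟨ sym (length-reduce u) ⟩
      length u                      ≡⟨ |u|≡|v| ⟩
      length v                      ≡⟨ length-reduce v ⟩
      length (reduce v) + removed v ≡⟨ cong (λ r → length r + removed v) (sym ru≡rv) ⟩
      length (reduce u) + removed v ∎)

  ones-reduce : ∀ u → ones (reduce u) ≡ ones u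
  ones-reduce u = sym (begin
    ones u                                ≡⟨ occ-reduce (true ∷ []) (s≤s z≤n) u ⟩
    ones (reduce u) + removed u * 0       ≡⟨ cong (ones (reduce u) +_) (*-zeroʳ (removed u)) ⟩
    ones (reduce u) + 0                   ≡⟨ +-identityʳ _ ⟩
    ones (reduce u)                       ∎)

  Reduced : List Bool → Set
  Reduced r = occ (zeros (suc m)) r ≡ 0

  Reduced-tail : ∀ a r → Reduced (a ∷ r) → Reduced r
  Reduced-tail _ _ = m+n≡0⇒n≡0 _

  reduce-Reduced : ∀ u → Reduced (reduce u)
  reduce-Reduced []          = refl
  reduce-Reduced (true ∷ u)  = reduce-Reduced u
  reduce-Reduced (false ∷ u) with isPrefix (zeros m) (reduce u) in eq
  ... | true  = reduce-Reduced u
  ... | false rewrite eq = reduce-Reduced u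

  leadingZeros-Reduced : ∀ r → Reduced r → leadingZeros r ≤ m
  leadingZeros-Reduced []      _   = z≤n
  leadingZeros-Reduced (a ∷ r) red with suc m ≤? leadingZeros (a ∷ r)
  ... | no  k≰ = ≤-pred (≰⇒> k≰)
  ... | yes k≤ = contradiction red (n>0⇒n≢0 (isPrefix⇒0<occ _ a r (zeros-isPrefix (suc m) (a ∷ r) k≤)))

  trailingZeros-Reduced : ∀ r → Reduced r → trailingZeros r ≤ m
  trailingZeros-Reduced []          _   = z≤n
  trailingZeros-Reduced (true ∷ r)  red = trailingZeros-Reduced r red
  trailingZeros-Reduced (false ∷ r) red with ones r in no-ones
  ... | suc _ = trailingZeros-Reduced r (Reduced-tail false r red)
  ... | zero  = subst (_≤ m) (cong suc (ones≡0⇒leadingZeros≡trailingZeros r no-ones))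
                  (leadingZeros-Reduced (false ∷ r) red)

  Spaced : List Bool → Set
  Spaced []          = ⊤
  Spaced (false ∷ u) = Spaced u
  Spaced (true ∷ u)  = ones (take m u) ≡ 0 × Spaced u

  reduce-Spaced : ∀ u → Spaced u → Spaced (reduce u)
  reduce-Spaced []          _          = tt
  reduce-Spaced (true ∷ u)  (gap , sp) = trans (cong ones (take-reduce m u ≤-refl)) gap , reduce-Spaced u sp
  reduce-Spaced (false ∷ u) sp with isPrefix (zeros m) (reduce u)
  ... | true  = reduce-Spaced u sp
  ... | false = reduce-Spaced u sp

  Spaced-factor : ∀ w → (∀ i → ones (factor w i (suc m)) ≤ 1) → ∀ i n → Spaced (factor w i n)
  Spaced-factor w window i zero    = tt
  Spaced-factor w window i (suc n) with w i | window i
  ... | false | _       = Spaced-factor w window (suc i) n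
  ... | true  | s≤s ≤0 = n≤0⇒n≡0 (≤-trans (ones-take-factor w (suc i) m n) ≤0)
                       , Spaced-factor w window (suc i) n

  Reduced-Spaced-unique : ∀ r₁ r₂ → Spaced r₁ → Spaced r₂ → Reduced r₁ → Reduced r₂
    → ones r₁ ≡ ones r₂ → leadingZeros r₁ ≡ leadingZeros r₂ → trailingZeros r₁ ≡ trailingZeros r₂
    → r₁ ≡ r₂
  Reduced-Spaced-unique []           []           _ _ _ _ _  _  _ = refl
  Reduced-Spaced-unique []           (true ∷ _)   _ _ _ _ () _  _
  Reduced-Spaced-unique []           (false ∷ _)  _ _ _ _ _  () _
  Reduced-Spaced-unique (true ∷ _)   []           _ _ _ _ () _  _
  Reduced-Spaced-unique (false ∷ _)  []           _ _ _ _ _  () _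
  Reduced-Spaced-unique (true ∷ _)   (false ∷ _)  _ _ _ _ _  () _
  Reduced-Spaced-unique (false ∷ _)  (true ∷ _)   _ _ _ _ _  () _
  Reduced-Spaced-unique (false ∷ r₁) (false ∷ r₂) sp₁ sp₂ red₁ red₂ o l t =
    cong (false ∷_) (Reduced-Spaced-unique r₁ r₂ sp₁ sp₂
      (Reduced-tail false r₁ red₁) (Reduced-tail false r₂ red₂) o (suc-injective l)
      (sucIfZero-injective (ones r₂) (subst (λ c → sucIfZero c (trailingZeros r₁) ≡ _) o t)))
  Reduced-Spaced-unique (true ∷ s₁)  (true ∷ s₂)  (gap₁ , sp₁) (gap₂ , sp₂) red₁ red₂ o _ t =
    cong (true ∷_) (after-one (ones s₁) refl)
    where
    o′ : ones s₁ ≡ ones s₂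
    o′ = suc-injective o

    leadingZeros≡m : ∀ s → ones (take m s) ≡ 0 → Reduced s → 0 < ones s → leadingZeros s ≡ m
    leadingZeros≡m s gap red p = ≤-antisym (leadingZeros-Reduced s red) (≤leadingZeros m s gap p)

    after-one : ∀ c → ones s₁ ≡ c → s₁ ≡ s₂
    after-one zero    e = begin
      s₁                       ≡⟨ ones≡0⇒≡zeros s₁ e ⟩
      zeros (trailingZeros s₁) ≡⟨ cong zeros t ⟩
      zeros (trailingZeros s₂) ≡⟨ sym (ones≡0⇒≡zeros s₂ (trans (sym o′) e)) ⟩
      s₂                       ∎
    after-one (suc c) e = Reduced-Spaced-unique s₁ s₂ sp₁ sp₂ red₁ red₂ o′
      (trans (leadingZeros≡m s₁ gap₁ red₁ p₁) (sym (leadingZeros≡m s₂ gap₂ red₂ p₂))) t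
      where
      p₁ : 0 < ones s₁
      p₁ = subst (0 <_) (sym e) (s≤s z≤n)
      p₂ : 0 < ones s₂
      p₂ = subst (0 <_) o′ p₁

  boundaryRuns : List Bool → Fin (suc m * suc m)
  boundaryRuns u = combine
    (fromℕ< (s≤s (leadingZeros-Reduced (reduce u) (reduce-Reduced u))))
    (fromℕ< (s≤s (trailingZeros-Reduced (reduce u) (reduce-Reduced u))))

  Spaced-≡ᴬ : ∀ u v → Spaced u → Spaced v → length u ≡ length v → ones u ≡ ones v
            → boundaryRuns u ≡ boundaryRuns v → u ≡[ suc m ]ᴬ v
  Spaced-≡ᴬ u v sp-u sp-v |u|≡|v| ones-≡ runs-≡ with combine-injective _ _ _ _ runs-≡
  ... | leading-≡ , trailing-≡ = reduce-≡⇒≡ᴬ u v |u|≡|v| (Reduced-Spaced-unique (reduce u) (reduce v)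
        (reduce-Spaced u sp-u) (reduce-Spaced v sp-v) (reduce-Reduced u) (reduce-Reduced v)
        (trans (ones-reduce u) (trans ones-≡ (sym (ones-reduce v))))
        (fromℕ<-injective _ _ _ _ leading-≡) (fromℕ<-injective _ _ _ _ trailing-≡))

same-representative⇒≡ᴬ : ∀ {k w n p} (pos : Fin p → ℕ)
  (cover : (i : ℕ) → ∃ λ (a : Fin p) → factor w i n ≡[ k ]ᴬ factor w (pos a) n)
  → ∀ i j → proj₁ (cover i) ≡ proj₁ (cover j) → factor w i n ≡[ k ]ᴬ factor w j n
same-representative⇒≡ᴬ {w = w} {n} pos cover i j same x l₁ l₂ = begin
  occ x (factor w i n)                       ≡⟨ proj₂ (cover i) x l₁ l₂ ⟩
  occ x (factor w (pos (proj₁ (cover i))) n) ≡⟨ cong (λ a → occ x (factor w (pos a) n)) same ⟩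
  occ x (factor w (pos (proj₁ (cover j))) n) ≡⟨ sym (proj₂ (cover j) x l₁ l₂) ⟩
  occ x (factor w j n)                       ∎

IsKAbComplexity-mono : ∀ {k l w n p q} → k ≤ l
  → IsKAbComplexity k w n q → IsKAbComplexity l w n p → q ≤ p
IsKAbComplexity-mono {k} {l} {w} {n} k≤l (pos , distinct , _) (pos′ , _ , cover′) = injective⇒≤ injective
  where
  injective : ∀ {a b} → proj₁ (cover′ (pos a)) ≡ proj₁ (cover′ (pos b)) → a ≡ b
  injective {a} {b} same = distinct a b λ x l₁ l₂ →
    same-representative⇒≡ᴬ {l} {w} {n} pos′ cover′ (pos a) (pos b) same x l₁ (≤-trans l₂ k≤l)

IsKAbComplexity-split : ∀ {k l w n p q c} (φ : ℕ → Fin c)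
  → (∀ i j → factor w i n ≡[ k ]ᴬ factor w j n → φ i ≡ φ j → factor w i n ≡[ l ]ᴬ factor w j n)
  → IsKAbComplexity l w n p → IsKAbComplexity k w n q → p ≤ c * q
IsKAbComplexity-split {k} {w = w} {n} φ refines (pos , distinct , _) (pos′ , _ , cover′) = injective⇒≤ injective
  where
  injective : ∀ {a b} → combine (φ (pos a)) (proj₁ (cover′ (pos a)))
                      ≡ combine (φ (pos b)) (proj₁ (cover′ (pos b))) → a ≡ b
  injective {a} {b} same with combine-injective _ _ _ _ same
  ... | φ-≡ , class-≡ = distinct a b (refines (pos a) (pos b)
        (same-representative⇒≡ᴬ {k} {w} {n} pos′ cover′ (pos a) (pos b) class-≡) φ-≡)

lemma1 : (k : ℕ) → 1 ≤ k → (w : InfWord)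
       → ((i : ℕ) → occ (true ∷ []) (factor w i k) ≤ 1)
       → ∃ λ (A : ℕ) → ∃ λ (B : ℕ) → ∃ λ (N : ℕ) →
           (n : ℕ) → N ≤ n → (p q : ℕ)
           → IsKAbComplexity k w n p → IsKAbComplexity 1 w n q
           → (q ≤ A * p) × (p ≤ B * q)
lemma1 (suc m) _ w window = 1 , suc m * suc m , 0 , bounds
  where
  open ZeroRuns m

  bounds : (n : ℕ) → 0 ≤ n → (p q : ℕ) → IsKAbComplexity (suc m) w n p → IsKAbComplexity 1 w n q
         → (q ≤ 1 * p) × (p ≤ (suc m * suc m) * q)
  bounds n _ p q Pₖ P₁ =
      ≤-trans (IsKAbComplexity-mono {w = w} {n} (s≤s z≤n) P₁ Pₖ) (m≤m+n p 0)
    , IsKAbComplexity-split {w = w} {n} (λ i → boundaryRuns (factor w i n)) refines Pₖ P₁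
    where
    refines : ∀ i j → factor w i n ≡[ 1 ]ᴬ factor w j n → boundaryRuns (factor w i n) ≡ boundaryRuns (factor w j n)
            → factor w i n ≡[ suc m ]ᴬ factor w j n
    refines i j abelian = Spaced-≡ᴬ (factor w i n) (factor w j n) (Spaced-factor w window i n) (Spaced-factor w window j n)
      (trans (length-factor w i n) (sym (length-factor w j n))) (abelian (true ∷ []) ≤-refl ≤-refl)
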